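{- Let $k,\ell\ge1$, $\vec r\in\mathbb Z_{\ge1}^k$, $\vec s\in\mathbb Z_{\ge1}^\ell$, $\vec t\in\mathbb Z_{\ge1}^{k+\ell}$ with $|\vec r|+|\vec s|=|\vec t|$. (1) Let $(\varphi,\psi)\in I_{k,\ell}$. If $\varphi(1)=1$, $s_1=1$ and $t_1>r_1$, or if $\psi(1)=1$, $r_1=1$ and $t_1>s_1$, then $c_{\vec r,\vec s}^{\vec t,(\varphi,\psi)}=0$. (2) If $t_1<\min(r_1,s_1)$, then $c_{\vec r,\vec s}^{\vec t,(\varphi,\psi)}=0$ for every $(\varphi,\psi)\in I_{k,\ell}$.
   Context: $[k]=\{1,\dots,k\}$; $|\vec x|$ is the sum of entries. $I_{k,\ell}$ is the set of pairs $(\varphi,\psi)$ of order-preserving injective maps $\varphi:[k]\to[k+\ell]$, $\psi:[\ell]\to[k+\ell]$ with $\mathrm{im}\,\varphi\sqcup\mathrm{im}\,\psi=[k+\ell]$. $h_i=r_j$ if $i=\varphi(j)$, $h_i=s_j$ if $i=\psi(j)$; $\varepsilon(i)=1$ if $i\in\mathrm{im}\,\varphi$, else $-1$. $c(i)=\binom{t_i-1}{h_i-1}$ if $i=1$ or ($i\ge2$ and $\varepsilon(i)=\varepsilon(i-1)$), and $c(i)=\binom{t_i-1}{\sum_{j\le i}t_j-\sum_{j\le i}h_j}$ if $i\ge2$ and $\varepsilon(i)\ne\varepsilon(i-1)$; for integers $a\ge0,b$, $\binom ab$ is the usual binomial coefficient when $0\le b\le a$ and $0$ otherwise. $c_{\vec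 r,\vec s}^{\vec t,(\varphi,\psi)}=\prod_{i=1}^{k+\ell}c(i)$. -}

module Defs where

open import Data.Nat using (ℕ; zero; suc; _∸_; _≤_; _≤?_)
open import Data.Nat.Combinatorics using (_C_)
open import Data.Integer using (ℤ; +_; -[1+_]; _⊖_)
open import Data.Fin using (Fin; zero; suc; toℕ; inject₁; _≟_)
open import Data.Fin.Properties using (any?)
open import Data.List using (List; map; filter; allFin)
open import Data.Nat.ListAction using (sum; product)
open import Data.Bool using (Bool; true; false; if_then_else_; _xor_)
open import Data.Product using (Σ; _,_; _×_; ∃)
open import Data.Sum using (_⊎_)
open import Relation.Nullary using (yes; no; does)
open import Relation.Binary.PropositionalEquality using (_≡_; _≢_)
open import Function.Definitions using (Injective)

∣_∣ᵥ : ∀ {n} → (Fin n → ℕ) → ℕ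
∣ x ∣ᵥ = sum (map x (allFin _))

-- Binomial coefficient with integer lower index: usual binomial if 0 ≤ b ≤ a, else 0.
-- (Data.Nat.Combinatorics._C_ already returns 0 when b > a.)
binomℤ : ℕ → ℤ → ℕ
binomℤ a (+ b)     = a C b
binomℤ a -[1+ b ]  = 0

OrderPreserving : ∀ {m n} → (Fin m → Fin n) → Set
OrderPreserving f = ∀ {a b} → toℕ a ≤ toℕ b → toℕ (f a) ≤ toℕ (f b)

-- I_{k,ℓ}: pairs (φ , ψ) of order-preserving injective maps [k] → [k+ℓ], [ℓ] → [k+ℓ]
-- whose images are disjoint and cover [k+ℓ].
record Shuffle (k ℓ : ℕ) : Set where
  field
    φ        : Fin k → Fin (k Data.Nat.+ ℓ)
    ψ        : Fin ℓ → Fin (k Data.Nat.+ ℓ)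
    φ-mono   : OrderPreserving φ
    ψ-mono   : OrderPreserving ψ
    φ-inj    : Injective _≡_ _≡_ φ
    ψ-inj    : Injective _≡_ _≡_ ψ
    disjoint : ∀ a b → φ a ≢ ψ b
    cover    : ∀ i → (∃ λ a → φ a ≡ i) ⊎ (∃ λ b → ψ b ≡ i)

open Shuffle public

module _ {k ℓ : ℕ} (σ : Shuffle k ℓ) (r : Fin k → ℕ) (s : Fin ℓ → ℕ) where

  -- ε(i) = true  iff  i ∈ im φ   (true ↔ 1, false ↔ -1)
  εₛ : Fin (k Data.Nat.+ ℓ) → Bool
  εₛ i = does (any? (λ a → φ σ a ≟ i))

  -- h_i = r_j if i = φ(j), s_j if i = ψ(j)  (the final 0 case cannot occur)
  hₛ : Fin (k Data.Nat.+ ℓ) → ℕ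
  hₛ i with any? (λ a → φ σ a ≟ i)
  ... | yes (a , _) = r a
  ... | no _ with any? (λ b → ψ σ b ≟ i)
  ...   | yes (b , _) = s b
  ...   | no _ = 0

prefix : ∀ {n} → (Fin n → ℕ) → Fin n → ℕ
prefix f i = sum (map f (filter (λ j → toℕ j ≤? toℕ i) (allFin _)))

cAt : ∀ {n} → (t h : Fin n → ℕ) → (ε : Fin n → Bool) → Fin n → ℕ
cAt t h ε zero    = (t zero ∸ 1) C (h zero ∸ 1)
cAt t h ε (suc i) =
  if ε (suc i) xor ε (inject₁ i)
  then binomℤ (t (suc i) ∸ 1) (prefix t (suc i) ⊖ prefix h (suc i))
  else (t (suc i) ∸ 1) C (h (suc i) ∸ 1)

coeff : ∀ {k ℓ} → (r : Fin k → ℕ) → (s : Fin ℓ → ℕ) → (t : Fin (k Data.Nat.+ ℓ) → ℕ)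
      → Shuffle k ℓ → ℕ
coeff r s t σ = product (map (cAt t (hₛ σ r s) (εₛ σ r s)) (allFin _))

{-# OPTIONS --safe #-}
-- If φ(1) = 1 and ψ first occurs at position m + 1 with s₁ = 1, then positions 1, …, m
-- all carry the same sign, so unless some factor vanishes, c(i) = C(tᵢ − 1, hᵢ − 1) ≠ 0
-- forces hᵢ ≤ tᵢ for 2 ≤ i ≤ m; together with h₁ = r₁ < t₁ this gives
-- Σ_{j ≤ m} hⱼ < Σ_{j ≤ m} tⱼ. At the sign change the lower index of c(m + 1) is then at
-- least t_{m+1} > t_{m+1} − 1, so that factor vanishes (the case ψ(1) = 1 is symmetric).
-- Part (2) is the first factor: its lower index h₁ − 1 ≥ min(r₁, s₁) − 1 exceeds t₁ − 1.
module Submission where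

open import Defs
open import Data.Nat using (ℕ; suc; _+_; _<_; _⊓_; _≤_)
open import Data.Fin using (Fin; zero)
open import Data.Product using (_×_)
open import Data.Sum using (_⊎_)
open import Relation.Binary.PropositionalEquality using (_≡_)

open import Data.Bool using (Bool; true; false; not)
open import Data.Empty using (⊥-elim)
open import Data.Fin using (suc; toℕ; inject₁) renaming (_≟_ to _≟ᶠ_)
open import Data.Fin.Properties using (any?; toℕ-inject₁; toℕ-injective)
open import Data.Integer using (_⊖_)
open import Data.Integer.Properties using (⊖-≥)
open import Data.List using (List; []; map; filter; allFin; tabulate)
open import Data.List.Membership.Propositional using (_∈_)
open import Data.List.Membership.Propositional.Properties using (∈-map⁺; ∈-allFin)
open import Data.List.Properties using (filter-accept; filter-reject; filter-none)
open import Data.List.Relation.Unary.All.Properties using (tabulate⁺)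
open import Data.Nat using (zero; _∸_; _≤?_; _≟_; z≤n; s≤s; s≤s⁻¹)
open import Data.Nat.Combinatorics using (_C_; k>n⇒nCk≡0)
open import Data.Nat.Divisibility using (0∣⇒≡0)
open import Data.Nat.ListAction using (sum; product)
open import Data.Nat.ListAction.Properties using (∈⇒∣product)
open import Data.Nat.Properties
open import Data.Product using (_,_)
open import Data.Sum using (inj₁; inj₂)
open import Function using (_∘_; id)
open import Relation.Binary.PropositionalEquality
  using (refl; sym; trans; cong; cong₂; subst; subst₂; _≢_; module ≡-Reasoning)
open import Relation.Nullary using (Dec; yes; no)

product-map-≡0 : ∀ {A : Set} (f : A → ℕ) {x : A} {xs : List A} →
                 x ∈ xs → f x ≡ 0 → product (map f xs) ≡ 0
product-map-≡0 f {xs = xs} x∈xs fx≡0 =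
  0∣⇒≡0 (∈⇒∣product (subst (_∈ map f xs) fx≡0 (∈-map⁺ f x∈xs)))

pred-C-pred-≡0 : ∀ {n k} → 1 ≤ n → n < k → (n ∸ 1) C (k ∸ 1) ≡ 0
pred-C-pred-≡0 1≤n n<k = k>n⇒nCk≡0 (∸-monoˡ-< n<k 1≤n)

pred-C-pred-≢0⇒≤ : ∀ {n k} → 1 ≤ n → (n ∸ 1) C (k ∸ 1) ≢ 0 → k ≤ n
pred-C-pred-≢0⇒≤ {k = zero}          _ _   = z≤n
pred-C-pred-≢0⇒≤ {suc n} {suc k} _ C≢0 = s≤s (≮⇒≥ (C≢0 ∘ k>n⇒nCk≡0))

binomℤ-⊖-≡0 : ∀ {a m n} → n + a < m → binomℤ a (m ⊖ n) ≡ 0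
binomℤ-⊖-≡0 {a} {m} {n} n+a<m rewrite ⊖-≥ (m+n≤o⇒m≤o n (<⇒≤ n+a<m)) =
  k>n⇒nCk≡0 (m+n≤o⇒m≤o∸n (suc a) (subst (_≤ m) (cong suc (+-comm n a)) n+a<m))

module _ {n : ℕ} (f : Fin (suc n) → ℕ) (m : ℕ) where
  open ≡-Reasoning

  private
    P : (j : Fin (suc n)) → Dec (toℕ j ≤ suc m)
    P j = toℕ j ≤? suc m

    Q : (j : Fin n) → Dec (toℕ j ≤ m)
    Q j = toℕ j ≤? m

  sum-filter-≤-suc : ∀ {k} (g : Fin k → Fin n) →
    sum (map f (filter P (tabulate (suc ∘ g)))) ≡ sum (map (f ∘ suc) (filter Q (tabulate g)))
  sum-filter-≤-suc {zero}  g = refl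
  sum-filter-≤-suc {suc k} g with Q (g zero)
  ... | yes x≤m = begin
    sum (map f (filter P (tabulate (suc ∘ g))))
      ≡⟨ cong (sum ∘ map f) (filter-accept P (s≤s x≤m)) ⟩
    f (suc (g zero)) + sum (map f (filter P (tabulate (suc ∘ g ∘ suc))))
      ≡⟨ cong (f (suc (g zero)) +_) (sum-filter-≤-suc (g ∘ suc)) ⟩
    f (suc (g zero)) + sum (map (f ∘ suc) (filter Q (tabulate (g ∘ suc))))
      ≡⟨ cong (sum ∘ map (f ∘ suc)) (filter-accept Q x≤m) ⟨
    sum (map (f ∘ suc) (filter Q (tabulate g))) ∎
  ... | no x≰m = begin
    sum (map f (filter P (tabulate (suc ∘ g))))
      ≡⟨ cong (sum ∘ map f) (filter-reject P (x≰m ∘ s≤s⁻¹)) ⟩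
    sum (map f (filter P (tabulate (suc ∘ g ∘ suc))))
      ≡⟨ sum-filter-≤-suc (g ∘ suc) ⟩
    sum (map (f ∘ suc) (filter Q (tabulate (g ∘ suc))))
      ≡⟨ cong (sum ∘ map (f ∘ suc)) (filter-reject Q x≰m) ⟨
    sum (map (f ∘ suc) (filter Q (tabulate g))) ∎

prefix-zero : ∀ {n} (f : Fin (suc n) → ℕ) → prefix f zero ≡ f zero
prefix-zero f = trans (cong (λ xs → f zero + sum (map f xs)) no-positive) (+-identityʳ (f zero))
  where
  no-positive : filter (λ j → toℕ j ≤? 0) (tabulate suc) ≡ []
  no-positive = filter-none (λ j → toℕ j ≤? 0) {xs = tabulate suc} (tabulate⁺ (λ _ ()))

prefix-shift : ∀ {n} (f : Fin (suc n) → ℕ) (i : Fin n) →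
               prefix f (suc i) ≡ f zero + prefix (f ∘ suc) i
prefix-shift f i = cong (f zero +_) (sum-filter-≤-suc f (toℕ i) id)

prefix-suc : ∀ {n} (f : Fin (suc n) → ℕ) (i : Fin n) →
             prefix f (suc i) ≡ prefix f (inject₁ i) + f (suc i)
prefix-suc f zero = trans (prefix-shift f zero)
  (cong₂ _+_ (sym (prefix-zero f)) (prefix-zero (f ∘ suc)))
prefix-suc f (suc i) = begin
  prefix f (suc (suc i))
    ≡⟨ prefix-shift f (suc i) ⟩
  f zero + prefix (f ∘ suc) (suc i)
    ≡⟨ cong (f zero +_) (prefix-suc (f ∘ suc) i) ⟩
  f zero + (prefix (f ∘ suc) (inject₁ i) + f (suc (suc i)))
    ≡⟨ +-assoc (f zero) _ _ ⟨
  (f zero + prefix (f ∘ suc) (inject₁ i)) + f (suc (suc i))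
    ≡⟨ cong (_+ f (suc (suc i))) (prefix-shift f (inject₁ i)) ⟨
  prefix f (suc (inject₁ i)) + f (suc (suc i)) ∎
  where open ≡-Reasoning

prefix-mono-≤ : ∀ {n} (h t : Fin (suc n) → ℕ) (i : Fin (suc n)) →
                (∀ j → toℕ j ≤ toℕ i → h j ≤ t j) → prefix h i ≤ prefix t i
prefix-mono-≤ h t zero h≤t =
  subst₂ _≤_ (sym (prefix-zero h)) (sym (prefix-zero t)) (h≤t zero z≤n)
prefix-mono-≤ {suc n} h t (suc i) h≤t =
  subst₂ _≤_ (sym (prefix-shift h i)) (sym (prefix-shift t i))
    (+-mono-≤ (h≤t zero z≤n) (prefix-mono-≤ (h ∘ suc) (t ∘ suc) i (λ j → h≤t (suc j) ∘ s≤s)))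

prefix-mono-< : ∀ {n} (h t : Fin (suc n) → ℕ) (i : Fin (suc n)) → h zero < t zero →
                (∀ j → toℕ j < toℕ i → h (suc j) ≤ t (suc j)) → prefix h i < prefix t i
prefix-mono-< h t zero h₀<t₀ _ =
  subst₂ _<_ (sym (prefix-zero h)) (sym (prefix-zero t)) h₀<t₀
prefix-mono-< {suc n} h t (suc i) h₀<t₀ h≤t =
  subst₂ _<_ (sym (prefix-shift h i)) (sym (prefix-shift t i))
    (+-mono-<-≤ h₀<t₀ (prefix-mono-≤ (h ∘ suc) (t ∘ suc) i (λ j → h≤t j ∘ s≤s)))

module _ {n : ℕ} (t h : Fin (suc n) → ℕ) (ε : Fin (suc n) → Bool) (t≥1 : ∀ j → 1 ≤ t j) where

  cAt-suc-same : ∀ i → ε (suc i) ≡ ε (inject₁ i) →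
                 cAt t h ε (suc i) ≡ (t (suc i) ∸ 1) C (h (suc i) ∸ 1)
  cAt-suc-same i same rewrite same with ε (inject₁ i)
  ... | true  = refl
  ... | false = refl

  cAt-suc-flip : ∀ i → ε (suc i) ≡ not (ε (inject₁ i)) →
                 cAt t h ε (suc i) ≡ binomℤ (t (suc i) ∸ 1) (prefix t (suc i) ⊖ prefix h (suc i))
  cAt-suc-flip i flip rewrite flip with ε (inject₁ i)
  ... | true  = refl
  ... | false = refl

  cAt-suc-same-≢0⇒≤ : ∀ i → ε (suc i) ≡ ε (inject₁ i) → cAt t h ε (suc i) ≢ 0 →
                      h (suc i) ≤ t (suc i)
  cAt-suc-same-≢0⇒≤ i same c≢0 =
    pred-C-pred-≢0⇒≤ (t≥1 (suc i)) (c≢0 ∘ trans (cAt-suc-same i same))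

  cAt-suc-flip-≡0 : ∀ i → ε (suc i) ≡ not (ε (inject₁ i)) → h (suc i) ≡ 1 →
                    prefix h (inject₁ i) < prefix t (inject₁ i) → cAt t h ε (suc i) ≡ 0
  cAt-suc-flip-≡0 i flip h≡1 deficit = begin
    cAt t h ε (suc i)
      ≡⟨ cAt-suc-flip i flip ⟩
    binomℤ (T ∸ 1) (prefix t (suc i) ⊖ prefix h (suc i))
      ≡⟨ cong₂ (λ x y → binomℤ (T ∸ 1) (x ⊖ y))
               (prefix-suc t i) (trans (prefix-suc h i) (cong (PH +_) h≡1)) ⟩
    binomℤ (T ∸ 1) ((PT + T) ⊖ (PH + 1))
      ≡⟨ binomℤ-⊖-≡0 {T ∸ 1} {PT + T} {PH + 1} bound ⟩
    0 ∎
    where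
    open ≡-Reasoning
    T  = t (suc i)
    PT = prefix t (inject₁ i)
    PH = prefix h (inject₁ i)
    bound : (PH + 1) + (T ∸ 1) < PT + T
    bound = subst (_< PT + T)
      (sym (trans (+-assoc PH 1 (T ∸ 1)) (cong (PH +_) (m+[n∸m]≡n (t≥1 (suc i))))))
      (+-monoˡ-< T deficit)

  product-cAt-≡0 : (i : Fin n) (b : Bool) → (∀ j → toℕ j ≤ toℕ i → ε j ≡ b) →
                   ε (suc i) ≡ not b → h (suc i) ≡ 1 → h zero < t zero →
                   product (map (cAt t h ε) (allFin (suc n))) ≡ 0
  product-cAt-≡0 i b run flip h≡1 h₀<t₀ with any? (λ j → cAt t h ε j ≟ 0)
  ... | yes (j , cⱼ≡0) = product-map-≡0 (cAt t h ε) (∈-allFin j) cⱼ≡0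
  ... | no no-zero =
    product-map-≡0 (cAt t h ε) (∈-allFin (suc i)) (cAt-suc-flip-≡0 i flip′ h≡1 deficit)
    where
    flip′ : ε (suc i) ≡ not (ε (inject₁ i))
    flip′ = trans flip (cong not (sym (run (inject₁ i) (≤-reflexive (toℕ-inject₁ i)))))
    same : ∀ j → toℕ j < toℕ (inject₁ i) → ε (suc j) ≡ ε (inject₁ j)
    same j j<i′ = trans (run (suc j) j<i)
                        (sym (run (inject₁ j) (≤-trans (≤-reflexive (toℕ-inject₁ j)) (<⇒≤ j<i))))
      where
      j<i : toℕ j < toℕ i
      j<i = subst (toℕ j <_) (toℕ-inject₁ i) j<i′
    deficit : prefix h (inject₁ i) < prefix t (inject₁ i)
    deficit = prefix-mono-< h t (inject₁ i) h₀<t₀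
      (λ j j<i → cAt-suc-same-≢0⇒≤ j (same j j<i) (no-zero ∘ (suc j ,_)))

module _ {k ℓ : ℕ} (σ : Shuffle k ℓ) (r : Fin k → ℕ) (s : Fin ℓ → ℕ) where

  εₛ-φ : ∀ {a i} → φ σ a ≡ i → εₛ σ r s i ≡ true
  εₛ-φ {a} {i} φa≡i with any? (λ a → φ σ a ≟ᶠ i)
  ... | yes _  = refl
  ... | no ∄a = ⊥-elim (∄a (a , φa≡i))

  εₛ-ψ : ∀ {b i} → ψ σ b ≡ i → εₛ σ r s i ≡ false
  εₛ-ψ {b} {i} ψb≡i with any? (λ a → φ σ a ≟ᶠ i)
  ... | yes (a , φa≡i) = ⊥-elim (disjoint σ a b (trans φa≡i (sym ψb≡i)))
  ... | no _           = refl

  hₛ-φ : ∀ {a i} → φ σ a ≡ i → hₛ σ r s i ≡ r a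
  hₛ-φ {a} {i} φa≡i with any? (λ a → φ σ a ≟ᶠ i)
  ... | yes (a′ , φa′≡i) = cong r (φ-inj σ (trans φa′≡i (sym φa≡i)))
  ... | no ∄a           = ⊥-elim (∄a (a , φa≡i))

  hₛ-ψ : ∀ {b i} → ψ σ b ≡ i → hₛ σ r s i ≡ s b
  hₛ-ψ {b} {i} ψb≡i with any? (λ a → φ σ a ≟ᶠ i)
  ... | yes (a , φa≡i) = ⊥-elim (disjoint σ a b (trans φa≡i (sym ψb≡i)))
  ... | no _ with any? (λ b → ψ σ b ≟ᶠ i)
  ...   | yes (b′ , ψb′≡i) = cong s (ψ-inj σ (trans ψb′≡i (sym ψb≡i)))
  ...   | no ∄b           = ⊥-elim (∄b (b , ψb≡i))

OrderPreserving-zero : ∀ {m n} {f : Fin (suc m) → Fin (suc n)} → OrderPreserving f →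
                       ∀ {a} → f a ≡ zero → f zero ≡ zero
OrderPreserving-zero {f = f} mono fa≡0 =
  toℕ-injective (n≤0⇒n≡0 (subst (λ u → toℕ (f zero) ≤ toℕ u) fa≡0 (mono z≤n)))

module _ {k′ ℓ′ : ℕ} (σ : Shuffle (suc k′) (suc ℓ′)) (r : Fin (suc k′) → ℕ) (s : Fin (suc ℓ′) → ℕ)
         (t : Fin (suc k′ + suc ℓ′) → ℕ) (t≥1 : ∀ j → 1 ≤ t j) where

  εₛ-below-ψ₀ : ∀ {i j} → ψ σ zero ≡ suc i → toℕ j ≤ toℕ i → εₛ σ r s j ≡ true
  εₛ-below-ψ₀ {j = j} ψ₀≡1+i j≤i with cover σ j
  ... | inj₁ (a , φa≡j) = εₛ-φ σ r s φa≡j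
  ... | inj₂ (b , ψb≡j) =
    ⊥-elim (<⇒≱ (subst₂ (λ u v → toℕ u ≤ toℕ v) ψ₀≡1+i ψb≡j (ψ-mono σ z≤n)) j≤i)

  εₛ-below-φ₀ : ∀ {i j} → φ σ zero ≡ suc i → toℕ j ≤ toℕ i → εₛ σ r s j ≡ false
  εₛ-below-φ₀ {j = j} φ₀≡1+i j≤i with cover σ j
  ... | inj₂ (b , ψb≡j) = εₛ-ψ σ r s ψb≡j
  ... | inj₁ (a , φa≡j) =
    ⊥-elim (<⇒≱ (subst₂ (λ u v → toℕ u ≤ toℕ v) φ₀≡1+i φa≡j (φ-mono σ z≤n)) j≤i)

  ⊓≤hₛ-zero : r zero ⊓ s zero ≤ hₛ σ r s zero
  ⊓≤hₛ-zero with cover σ zero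
  ... | inj₁ (a , φa≡0) = subst (_ ≤_) (sym (hₛ-φ σ r s (OrderPreserving-zero (φ-mono σ) φa≡0)))
                            (m⊓n≤m (r zero) (s zero))
  ... | inj₂ (b , ψb≡0) = subst (_ ≤_) (sym (hₛ-ψ σ r s (OrderPreserving-zero (ψ-mono σ) ψb≡0)))
                            (m⊓n≤n (r zero) (s zero))

  coeff-≡0-φ-first : φ σ zero ≡ zero → s zero ≡ 1 → r zero < t zero → coeff r s t σ ≡ 0
  coeff-≡0-φ-first φ₀≡0 s₀≡1 r₀<t₀ = from-ψ₀ (ψ σ zero) refl
    where
    from-ψ₀ : ∀ x → ψ σ zero ≡ x → coeff r s t σ ≡ 0
    from-ψ₀ zero    ψ₀≡0   = ⊥-elim (disjoint σ zero zero (trans φ₀≡0 (sym ψ₀≡0)))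
    from-ψ₀ (suc i) ψ₀≡1+i = product-cAt-≡0 t (hₛ σ r s) (εₛ σ r s) t≥1 i true
      (λ _ → εₛ-below-ψ₀ ψ₀≡1+i) (εₛ-ψ σ r s ψ₀≡1+i) (trans (hₛ-ψ σ r s ψ₀≡1+i) s₀≡1)
      (subst (_< t zero) (sym (hₛ-φ σ r s φ₀≡0)) r₀<t₀)

  coeff-≡0-ψ-first : ψ σ zero ≡ zero → r zero ≡ 1 → s zero < t zero → coeff r s t σ ≡ 0
  coeff-≡0-ψ-first ψ₀≡0 r₀≡1 s₀<t₀ = from-φ₀ (φ σ zero) refl
    where
    from-φ₀ : ∀ x → φ σ zero ≡ x → coeff r s t σ ≡ 0
    from-φ₀ zero    φ₀≡0   = ⊥-elim (disjoint σ zero zero (trans φ₀≡0 (sym ψ₀≡0)))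
    from-φ₀ (suc i) φ₀≡1+i = product-cAt-≡0 t (hₛ σ r s) (εₛ σ r s) t≥1 i false
      (λ _ → εₛ-below-φ₀ φ₀≡1+i) (εₛ-φ σ r s φ₀≡1+i) (trans (hₛ-φ σ r s φ₀≡1+i) r₀≡1)
      (subst (_< t zero) (sym (hₛ-ψ σ r s ψ₀≡0)) s₀<t₀)

  coeff-≡0-t₀<⊓ : t zero < r zero ⊓ s zero → coeff r s t σ ≡ 0
  coeff-≡0-t₀<⊓ t₀<⊓ =
    product-map-≡0 (cAt t (hₛ σ r s) (εₛ σ r s)) (∈-allFin zero)
      (pred-C-pred-≡0 (t≥1 zero) (<-≤-trans t₀<⊓ ⊓≤hₛ-zero))

lemma3p2 : (k' ℓ' : ℕ)
    → (r : Fin (suc k') → ℕ) → (s : Fin (suc ℓ') → ℕ) → (t : Fin (suc k' + suc ℓ') → ℕ)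
    → (∀ j → 1 ≤ r j) → (∀ j → 1 ≤ s j) → (∀ j → 1 ≤ t j)
    → ∣ r ∣ᵥ + ∣ s ∣ᵥ ≡ ∣ t ∣ᵥ
    → ((σ : Shuffle (suc k') (suc ℓ'))
         → ((φ σ zero ≡ zero × s zero ≡ 1 × r zero < t zero)
            ⊎ (ψ σ zero ≡ zero × r zero ≡ 1 × s zero < t zero))
         → coeff r s t σ ≡ 0)
      × (t zero < r zero ⊓ s zero
         → (σ : Shuffle (suc k') (suc ℓ')) → coeff r s t σ ≡ 0)
lemma3p2 k' ℓ' r s t _ _ t≥1 _ = part1 , part2
  where
  part1 : (σ : Shuffle (suc k') (suc ℓ'))
        → ((φ σ zero ≡ zero × s zero ≡ 1 × r zero < t zero)
           ⊎ (ψ σ zero ≡ zero × r zero ≡ 1 × s zero < t zero))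
        → coeff r s t σ ≡ 0
  part1 σ (inj₁ (φ₀≡0 , s₀≡1 , r₀<t₀)) = coeff-≡0-φ-first σ r s t t≥1 φ₀≡0 s₀≡1 r₀<t₀
  part1 σ (inj₂ (ψ₀≡0 , r₀≡1 , s₀<t₀)) = coeff-≡0-ψ-first σ r s t t≥1 ψ₀≡0 r₀≡1 s₀<t₀

  part2 : t zero < r zero ⊓ s zero → (σ : Shuffle (suc k') (suc ℓ')) → coeff r s t σ ≡ 0
  part2 t₀<⊓ σ = coeff-≡0-t₀<⊓ σ r s t t≥1 t₀<⊓
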